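{- Let $(V,d)$ be a finite metric space and $F,F^*\subseteq V$ with $|F|=|F^*|=k$; let $t\ge1$ be an integer. Let $\eta:F^*\to F$ map each optimal facility to a closest facility of $F$, and let $\deg(r)=|\eta^{ -1}(r)|$ for $r\in F$. Construct sequences $(R_i)$, $(F^*_i)$ as follows: set $G=F$, $G^*=F^*$; while some $r\in G$ has $\deg(r)>0$, let $R_i$ consist of $r$ together with any $\deg(r)-1$ elements of $G$ of degree $0$, let $F^*_i=\eta^{ -1}(R_i)$, remove $R_i$ from $G$ and $F^*_i$ from $G^*$, and increase $i$; finally let the last pair be $(G,G^*)$. Let $\varphi:V\to F$, $\varphi^*:V\to F^*$ be closest-facility maps, $A_j=d(j,\varphi(j))$, $O_j=d(j,\varphi^*(j))$, and for $X\subseteq F$, $X^*\subseteq F^*$ let $N(X)=\{j:\varphi(j)\in X\}$, $N^*(X^*)=\{j:\varphi^*(j)\in X^*\}$. If $(R_i,F^*_i)$ is one of the constructed pairs with $|R_i|=|F^*_i|=s>t$, and $\widehat R_i$ is a set of $s-1$ degree-$0$ elements of $R_i$, then \[\frac{1}{s-1}\sum_{(f^*,r)\in F^*_i\times\widehat R_i}\Big[\mathrm{kmed}\big((F\cup\{f^*\})\setminus\{r\}\big)-\mathrm{kmed}(F)\Big]\le\sum_{j\in N^*(F^*_i)}(O_j-A_j)+\sum_{j\in N(R_i)}2\Big(1+\frac1t\Big)O_j,\] where $\mathrm{kmed}(G)=\sum_{j\in V}d(j,G)$ with $d(j,G)=\min_{g\in G}d(j,g)$.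
   Context: All points of $V$ are clients. Ties in closest-facility maps are broken arbitrarily. Degrees are with respect to the fixed map $\eta$.
   Formalization: The distances of the metric space $(V,d)$ take rational values. -}

module Defs where

open import Data.Nat using (ℕ; zero; suc; _∸_; _>_)
open import Data.Bool using (Bool; true; false; _∧_; if_then_else_)
open import Data.Fin using (Fin)
open import Data.Fin.Subset using (Subset; _∈_; _∉_; _⊆_; _∪_; _─_; ⁅_⁆; ∣_∣)
open import Data.Vec using (lookup; tabulate)
open import Data.List using (List; []; _∷_; foldr; allFin)
open import Data.Integer using (+_)
open import Data.Rational using (ℚ; 0ℚ; _+_; _⊓_; _/_; _≤_)
open import Relation.Binary.PropositionalEquality using (_≡_)
open import Data.Product using (Σ; _×_)

sumOver : ∀ {n} → Subset n → (Fin n → ℚ) → ℚ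
sumOver {n} G f = foldr (λ i acc → (if lookup G i then f i else 0ℚ) + acc) 0ℚ (allFin n)

-- Minimum of a list of rationals; the first argument is returned for the
-- empty list (only ever used on nonempty sets in the theorem).
minList : ℚ → List ℚ → ℚ
minList dflt [] = dflt
minList _ (x ∷ xs) = foldr _⊓_ x xs

minOver : ∀ {n} → Subset n → (Fin n → ℚ) → ℚ
minOver {n} G f = minList 0ℚ (foldr (λ i acc → if lookup G i then f i ∷ acc else acc) [] (allFin n))

distSet : ∀ {n} → (Fin n → Fin n → ℚ) → Fin n → Subset n → ℚ
distSet d j G = minOver G (λ g → d j g)

-- kmed(G) = Σ_{j ∈ V} d(j, G), V = Fin n (all points are clients)
kmed : ∀ {n} → (Fin n → Fin n → ℚ) → Subset n → ℚ
kmed {n} d G = foldr (λ j acc → distSet d j G + acc) 0ℚ (allFin n)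

-- 1/m as a rational (1/0 := 0; only used with m ≥ 1)
inv : ℕ → ℚ
inv zero = 0ℚ
inv (suc m) = + 1 / suc m

record IsMetric {n : ℕ} (d : Fin n → Fin n → ℚ) : Set where
  field
    zero-iff₁ : ∀ x → d x x ≡ 0ℚ
    zero-iff₂ : ∀ x y → d x y ≡ 0ℚ → x ≡ y
    nonneg    : ∀ x y → 0ℚ ≤ d x y
    symm      : ∀ x y → d x y ≡ d y x
    triangle  : ∀ x y z → d x z ≤ d x y + d y z

IsClosestMap : ∀ {n} → (Fin n → Fin n → ℚ) → Subset n → (Fin n → Fin n) → Set
IsClosestMap d F φ = ∀ j → φ j ∈ F × (∀ f → f ∈ F → d j (φ j) ≤ d j f)

-- η⁻¹(X) ∩ F*  (η is only meaningful on F*)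
preimage : ∀ {n} → Subset n → (Fin n → Fin n) → Subset n → Subset n
preimage Fs η X = tabulate (λ i → lookup Fs i ∧ lookup X (η i))

deg : ∀ {n} → Subset n → (Fin n → Fin n) → Fin n → ℕ
deg Fs η r = ∣ preimage Fs η ⁅ r ⁆ ∣

-- {j : φ(j) ∈ X}  (used for both N and N*)
nbhd : ∀ {n} → (Fin n → Fin n) → Subset n → Subset n
nbhd {n} φ X = tabulate (λ j → lookup X (φ j))

IsBlock : ∀ {n} → Subset n → (Fin n → Fin n) → Subset n → Subset n → Set
IsBlock {n} Fs η G R =
  Σ (Fin n) λ r → Σ (Subset n) λ Z →
    r ∈ G × deg Fs η r > 0 × Z ⊆ G × (∀ x → x ∈ Z → deg Fs η x ≡ 0)
    × ∣ Z ∣ ≡ deg Fs η r ∸ 1 × R ≡ ⁅ r ⁆ ∪ Z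

-- Constructed Fs η G G* R Fi : the pair (R, Fi) is one of the pairs output by
-- some run of the procedure started in state (G, G*).
data Constructed {n : ℕ} (Fs : Subset n) (η : Fin n → Fin n)
     : Subset n → Subset n → Subset n → Subset n → Set where
  here  : ∀ {G Gs R} → IsBlock Fs η G R →
          Constructed Fs η G Gs R (preimage Fs η R)
  there : ∀ {G Gs R' R Fi} → IsBlock Fs η G R' →
          Constructed Fs η (G ─ R') (Gs ─ preimage Fs η R') R Fi →
          Constructed Fs η G Gs R Fi
  final : ∀ {G Gs} → (∀ r → r ∈ G → deg Fs η r ≡ 0) →
          Constructed Fs η G Gs G Gs

{-# OPTIONS --safe #-}
-- Swap an optimal facility f* ∈ F*ᵢ in for a degree-0 facility r ∈ R̂ᵢ and reassign clients:
-- those of f* move to f* (change O − A); those of r move to η(φ*(j)), which survives the swap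
-- because nothing is mapped to r, at cost at most 2O by the triangle inequality and the choice
-- of η; everyone else keeps φ(j). Summing over F*ᵢ × R̂ᵢ counts each f* exactly s − 1 times
-- and each r exactly s times, and s/(s − 1) ≤ 1 + 1/t because s − 1 ≥ t.
module Submission where

open import Defs
open import Data.Nat using (ℕ; _≤_; _<_; _∸_)
open import Data.Fin using (Fin)
open import Data.Fin.Subset using (Subset; _∈_; _⊆_; _∪_; _─_; ⁅_⁆; ∣_∣)
open import Data.Rational using (ℚ; 1ℚ) renaming (_+_ to _+ℚ_; _-_ to _-ℚ_; _*_ to _*ℚ_; _≤_ to _≤ℚ_)
open import Relation.Binary.PropositionalEquality using (_≡_)
open import Data.Product using (_×_)

open import Algebra.Bundles using (Ring)
open import Data.Bool using (true; false; _∧_; if_then_else_)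
open import Data.Fin using (zero; suc; _≟_)
open import Data.Fin.Subset using (_∉_; inside; outside)
import Data.Fin.Subset.Properties as Subsetₚ
open import Data.Integer using (+_; +≤+)
import Data.Integer as ℤ
import Data.Integer.Properties as ℤ
open import Data.List using (List; []; _∷_; foldr; allFin)
import Data.List as List
open import Data.List.Membership.Propositional using () renaming (_∈_ to _∈ₗ_)
open import Data.List.Membership.Propositional.Properties using (∈-allFin)
open import Data.List.Properties using (foldr-preservesᵇ; foldr-preservesᵒ)
open import Data.List.Relation.Unary.All using (All; []; _∷_)
open import Data.List.Relation.Unary.Any as Any using (here; there)
open import Data.Nat using (zero; suc; z≤n; s≤s)
import Data.Nat.Coprimality as Coprime
import Data.Nat.Properties as ℕ
open import Data.Product using (_,_; proj₁; proj₂)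
open import Data.Rational using (0ℚ; _⊓_; mkℚ; 1/_; -_; nonNegative; *≤*)
import Data.Rational.Properties as ℚ
open import Data.Rational.Solver using (module +-*-Solver)
open import Data.Sum using (_⊎_; inj₁; inj₂)
open import Data.Vec using ([]; _∷_; lookup)
import Data.Vec.Properties as Vec
open import Function using (_∘_; id)
open import Relation.Binary.PropositionalEquality using (_≢_; refl; sym; trans; cong; cong₂; subst; subst₂; module ≡-Reasoning)
open import Relation.Nullary using (yes; no; contradiction)

private
  ℚ-semiring = Ring.semiring ℚ.+-*-ring

open import Algebra.Properties.Semiring.Sum ℚ-semiring
  using (sum; ∑-comm; ∑-distrib-+; *-distribˡ-sum; sum-cong-≗; sum-replicate-zero)
open import Algebra.Properties.Semiring.Mult ℚ-semiring
  using (×-assoc-*) renaming (_×_ to _×ℚ_)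
open +-*-Solver

ℚ[1+_] : ℕ → ℚ
ℚ[1+ m ] = mkℚ (+ suc m) 0 (Coprime.sym (Coprime.1-coprimeTo (suc m)))

suc×1ℚ : ∀ m → suc m ×ℚ 1ℚ ≡ ℚ[1+ m ]
suc×1ℚ zero = refl
suc×1ℚ (suc m) = trans (cong (1ℚ +ℚ_) (suc×1ℚ m))
  (trans (ℚ./-cong {p₂ = + suc (suc m)} {q₂ = 1} (cong (ℤ._+_ (+ 1)) (ℤ.*-identityʳ (+ suc m))) refl)
         (ℚ.↥p/↧p≡p ℚ[1+ suc m ]))

inv-suc : ∀ m → inv (suc m) ≡ 1/ ℚ[1+ m ]
inv-suc m = ℚ.↥p/↧p≡p (mkℚ (+ 1) m (Coprime.1-coprimeTo (suc m)))

inv-*-× : ∀ m p → inv (suc m) *ℚ (suc m ×ℚ p) ≡ p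
inv-*-× m p = begin
  inv (suc m) *ℚ (suc m ×ℚ p)                ≡⟨ cong (λ q → inv (suc m) *ℚ (suc m ×ℚ q)) (sym (ℚ.*-identityˡ p)) ⟩
  inv (suc m) *ℚ (suc m ×ℚ (1ℚ *ℚ p))        ≡⟨ cong (inv (suc m) *ℚ_) (sym (×-assoc-* (suc m) 1ℚ p)) ⟩
  inv (suc m) *ℚ ((suc m ×ℚ 1ℚ) *ℚ p)        ≡⟨ sym (ℚ.*-assoc (inv (suc m)) _ p) ⟩
  (inv (suc m) *ℚ (suc m ×ℚ 1ℚ)) *ℚ p        ≡⟨ cong₂ (λ a b → a *ℚ b *ℚ p) (inv-suc m) (suc×1ℚ m) ⟩
  (1/ ℚ[1+ m ] *ℚ ℚ[1+ m ]) *ℚ p              ≡⟨ cong (_*ℚ p) (ℚ.*-inverseˡ ℚ[1+ m ]) ⟩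
  1ℚ *ℚ p                                     ≡⟨ ℚ.*-identityˡ p ⟩
  p                                           ∎
  where open ≡-Reasoning

inv-nonneg : ∀ m → 0ℚ ≤ℚ inv m
inv-nonneg zero = ℚ.≤-refl
inv-nonneg (suc m) rewrite inv-suc m = *≤* (+≤+ z≤n)

inv-antitone : ∀ {t m} → t ≤ m → inv (suc m) ≤ℚ inv (suc t)
inv-antitone {t} {m} t≤m rewrite inv-suc m | inv-suc t = *≤* (+≤+ (s≤s (ℕ.+-monoˡ-≤ 0 t≤m)))

p≤q+r⇒p-q≤r : ∀ {p q r} → p ≤ℚ q +ℚ r → p -ℚ q ≤ℚ r
p≤q+r⇒p-q≤r {p} {q} {r} p≤q+r = ℚ.≤-trans (ℚ.+-monoˡ-≤ (- q) p≤q+r)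
  (ℚ.≤-reflexive (solve 2 (λ q r → (q :+ r) :- q := r) refl q r))

average-bound : ∀ {t m} → t ≤ m → ∀ p {q q′} → 0ℚ ≤ℚ q → q ≤ℚ q′ →
                inv (suc m) *ℚ (suc m ×ℚ p +ℚ suc (suc m) ×ℚ q) ≤ℚ p +ℚ (1ℚ +ℚ inv (suc t)) *ℚ q′
average-bound {t} {m} t≤m p {q} {q′} 0≤q q≤q′ = begin
  w *ℚ (suc m ×ℚ p +ℚ (q +ℚ suc m ×ℚ q))         ≡⟨ solve 4 (λ w a q b → w :* (a :+ (q :+ b)) := w :* a :+ (w :* b :+ w :* q))
                                                          refl w (suc m ×ℚ p) q (suc m ×ℚ q) ⟩
  w *ℚ (suc m ×ℚ p) +ℚ (w *ℚ (suc m ×ℚ q) +ℚ w *ℚ q) ≡⟨ cong₂ (λ a b → a +ℚ (b +ℚ w *ℚ q)) (inv-*-× m p) (inv-*-× m q) ⟩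
  p +ℚ (q +ℚ w *ℚ q)                              ≤⟨ ℚ.+-monoʳ-≤ p (ℚ.+-mono-≤ q≤q′ wq≤w′q′) ⟩
  p +ℚ (q′ +ℚ w′ *ℚ q′)                           ≡⟨ cong (p +ℚ_) (solve 2 (λ w′ q′ → q′ :+ w′ :* q′ := (con 1ℚ :+ w′) :* q′) refl w′ q′) ⟩
  p +ℚ (1ℚ +ℚ w′) *ℚ q′                           ∎
  where
  open ℚ.≤-Reasoning
  w = inv (suc m)
  w′ = inv (suc t)
  wq≤w′q′ : w *ℚ q ≤ℚ w′ *ℚ q′
  wq≤w′q′ = ℚ.≤-trans (ℚ.*-monoʳ-≤-nonNeg q {{nonNegative 0≤q}} (inv-antitone t≤m))
                      (ℚ.*-monoˡ-≤-nonNeg w′ {{nonNegative (inv-nonneg (suc t))}} q≤q′)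

sum-mono : ∀ {m} {f g : Fin m → ℚ} → (∀ i → f i ≤ℚ g i) → sum f ≤ℚ sum g
sum-mono {zero}  _   = ℚ.≤-refl
sum-mono {suc m} f≤g = ℚ.+-mono-≤ (f≤g zero) (sum-mono (f≤g ∘ suc))

restrict : ∀ {n} → Subset n → (Fin n → ℚ) → Fin n → ℚ
restrict G f i = if lookup G i then f i else 0ℚ

module _ {n : ℕ} where

  restrict-∈ : ∀ {G : Subset n} {i} (f : Fin n → ℚ) → i ∈ G → restrict G f i ≡ f i
  restrict-∈ f i∈G rewrite Vec.[]=⇒lookup i∈G = refl

  restrict-∉ : ∀ {G : Subset n} {i} (f : Fin n → ℚ) → i ∉ G → restrict G f i ≡ 0ℚ
  restrict-∉ {G} {i} f i∉G with lookup G i in eq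
  ... | true  = contradiction (Vec.lookup⇒[]= i G eq) i∉G
  ... | false = refl

  restrict-zero : ∀ {m} (G : Subset m) i → restrict G (λ _ → 0ℚ) i ≡ 0ℚ
  restrict-zero G i with lookup G i
  ... | true  = refl
  ... | false = refl

  restrict-nonneg : ∀ (G : Subset n) {f : Fin n → ℚ} → (∀ i → 0ℚ ≤ℚ f i) → ∀ i → 0ℚ ≤ℚ restrict G f i
  restrict-nonneg G f≥0 i with lookup G i
  ... | true  = f≥0 i
  ... | false = ℚ.≤-refl

  foldr-tabulate : ∀ {m} (h : Fin m → Fin n) (g : Fin n → ℚ) →
                   foldr (λ i acc → g i +ℚ acc) 0ℚ (List.tabulate h) ≡ sum (g ∘ h)
  foldr-tabulate {zero}  h g = refl
  foldr-tabulate {suc m} h g = cong (g (h zero) +ℚ_) (foldr-tabulate (h ∘ suc) g)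

  sumOver≡sum : ∀ (G : Subset n) f → sumOver G f ≡ sum (restrict G f)
  sumOver≡sum G f = foldr-tabulate id (restrict G f)

  kmed≡sum : ∀ (d : Fin n → Fin n → ℚ) G → kmed d G ≡ sum (λ j → distSet d j G)
  kmed≡sum d G = foldr-tabulate id (λ j → distSet d j G)

  sumOver-cong : ∀ (G : Subset n) {f g} → (∀ i → f i ≡ g i) → sumOver G f ≡ sumOver G g
  sumOver-cong G {f} {g} f≗g = begin
    sumOver G f           ≡⟨ sumOver≡sum G f ⟩
    sum (restrict G f)    ≡⟨ sum-cong-≗ (λ i → cong (λ v → if lookup G i then v else 0ℚ) (f≗g i)) ⟩
    sum (restrict G g)    ≡⟨ sumOver≡sum G g ⟨
    sumOver G g           ∎
    where open ≡-Reasoning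

  sumOver-mono : ∀ (G : Subset n) {f g} → (∀ i → i ∈ G → f i ≤ℚ g i) → sumOver G f ≤ℚ sumOver G g
  sumOver-mono G {f} {g} f≤g = subst₂ _≤ℚ_ (sym (sumOver≡sum G f)) (sym (sumOver≡sum G g)) (sum-mono pointwise)
    where
    pointwise : ∀ i → restrict G f i ≤ℚ restrict G g i
    pointwise i with lookup G i in eq
    ... | true  = f≤g i (Vec.lookup⇒[]= i G eq)
    ... | false = ℚ.≤-refl

  sumOver-mono-⊆ : ∀ {G H : Subset n} {f} → G ⊆ H → (∀ i → 0ℚ ≤ℚ f i) → sumOver G f ≤ℚ sumOver H f
  sumOver-mono-⊆ {G} {H} {f} G⊆H f≥0 = subst₂ _≤ℚ_ (sym (sumOver≡sum G f)) (sym (sumOver≡sum H f)) (sum-mono pointwise)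
    where
    pointwise : ∀ i → restrict G f i ≤ℚ restrict H f i
    pointwise i with lookup G i in eq
    ... | true rewrite Vec.[]=⇒lookup (G⊆H (Vec.lookup⇒[]= i G eq)) = ℚ.≤-refl
    ... | false = restrict-nonneg H f≥0 i

  sumOver-nonneg : ∀ (G : Subset n) {f} → (∀ i → 0ℚ ≤ℚ f i) → 0ℚ ≤ℚ sumOver G f
  sumOver-nonneg G {f} f≥0 = subst₂ _≤ℚ_ (sum-replicate-zero n) (sym (sumOver≡sum G f))
                                       (sum-mono (restrict-nonneg G f≥0))

  sumOver-zero : ∀ (G : Subset n) → sumOver G (λ _ → 0ℚ) ≡ 0ℚ
  sumOver-zero G = trans (sumOver≡sum G _) (trans (sum-cong-≗ (restrict-zero G)) (sum-replicate-zero n))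

  sumOver-+ : ∀ (G : Subset n) f g → sumOver G (λ i → f i +ℚ g i) ≡ sumOver G f +ℚ sumOver G g
  sumOver-+ G f g = begin
    sumOver G (λ i → f i +ℚ g i)                         ≡⟨ sumOver≡sum G _ ⟩
    sum (restrict G (λ i → f i +ℚ g i))                  ≡⟨ sum-cong-≗ restrict-+ ⟩
    sum (λ i → restrict G f i +ℚ restrict G g i)         ≡⟨ ∑-distrib-+ (restrict G f) (restrict G g) ⟩
    sum (restrict G f) +ℚ sum (restrict G g)             ≡⟨ cong₂ _+ℚ_ (sumOver≡sum G f) (sumOver≡sum G g) ⟨
    sumOver G f +ℚ sumOver G g                           ∎
    where
    open ≡-Reasoning
    restrict-+ : ∀ i → restrict G (λ i → f i +ℚ g i) i ≡ restrict G f i +ℚ restrict G g i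
    restrict-+ i with lookup G i
    ... | true  = refl
    ... | false = sym (ℚ.+-identityˡ 0ℚ)

  sumOver-*ˡ : ∀ (G : Subset n) c f → sumOver G (λ i → c *ℚ f i) ≡ c *ℚ sumOver G f
  sumOver-*ˡ G c f = begin
    sumOver G (λ i → c *ℚ f i)             ≡⟨ sumOver≡sum G _ ⟩
    sum (restrict G (λ i → c *ℚ f i))      ≡⟨ sum-cong-≗ restrict-* ⟩
    sum (λ i → c *ℚ restrict G f i)        ≡⟨ *-distribˡ-sum c (restrict G f) ⟨
    c *ℚ sum (restrict G f)                ≡⟨ cong (c *ℚ_) (sumOver≡sum G f) ⟨
    c *ℚ sumOver G f                       ∎
    where
    open ≡-Reasoning
    restrict-* : ∀ i → restrict G (λ i → c *ℚ f i) i ≡ c *ℚ restrict G f i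
    restrict-* i with lookup G i
    ... | true  = refl
    ... | false = sym (ℚ.*-zeroʳ c)

  sumOver-× : ∀ (G : Subset n) m f → sumOver G (λ i → m ×ℚ f i) ≡ m ×ℚ sumOver G f
  sumOver-× G zero    f = sumOver-zero G
  sumOver-× G (suc m) f = trans (sumOver-+ G f _) (cong (sumOver G f +ℚ_) (sumOver-× G m f))

  sumOver-const : ∀ (G : Subset n) c → sumOver G (λ _ → c) ≡ ∣ G ∣ ×ℚ c
  sumOver-const G c = trans (sumOver≡sum G _) (sum-restrict-const G)
    where
    sum-restrict-const : ∀ {m} (G : Subset m) → sum (restrict G (λ _ → c)) ≡ ∣ G ∣ ×ℚ c
    sum-restrict-const []            = refl
    sum-restrict-const (inside ∷ G)  = cong (c +ℚ_) (sum-restrict-const G)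
    sum-restrict-const (outside ∷ G) = trans (ℚ.+-identityˡ _) (sum-restrict-const G)

  sumOver-sum-comm : ∀ (G : Subset n) {m} (h : Fin n → Fin m → ℚ) →
                     sumOver G (λ x → sum (h x)) ≡ sum (λ j → sumOver G (λ x → h x j))
  sumOver-sum-comm G {m} h = begin
    sumOver G (λ x → sum (h x))                       ≡⟨ sumOver≡sum G _ ⟩
    sum (restrict G (λ x → sum (h x)))                ≡⟨ sum-cong-≗ restrict-sum ⟩
    sum (λ x → sum (λ j → restrict G (λ x → h x j) x)) ≡⟨ ∑-comm (λ x j → restrict G (λ x → h x j) x) ⟩
    sum (λ j → sum (restrict G (λ x → h x j)))        ≡⟨ sum-cong-≗ (λ j → sumOver≡sum G (λ x → h x j)) ⟨
    sum (λ j → sumOver G (λ x → h x j))               ∎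
    where
    open ≡-Reasoning
    restrict-sum : ∀ x → restrict G (λ x → sum (h x)) x ≡ sum (λ j → restrict G (λ x → h x j) x)
    restrict-sum x with lookup G x
    ... | true  = refl
    ... | false = sym (sum-replicate-zero m)

  sumOver-⁅⁆ : ∀ (G : Subset n) y c → sumOver G (λ x → restrict ⁅ x ⁆ (λ _ → c) y) ≡ restrict G (λ _ → c) y
  sumOver-⁅⁆ G y c = trans (sumOver≡sum G _) (sum-restrict-⁅⁆ G y)
    where
    sum-restrict-⁅⁆ : ∀ {m} (G : Subset m) y →
                      sum (restrict G (λ x → restrict ⁅ x ⁆ (λ _ → c) y)) ≡ restrict G (λ _ → c) y
    sum-restrict-⁅⁆ {suc m} (b ∷ G) zero = trans (cong (restrict (b ∷ G) (λ _ → c) zero +ℚ_)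
        (trans (sum-cong-≗ (restrict-zero G)) (sum-replicate-zero m)))
      (ℚ.+-identityʳ _)
    sum-restrict-⁅⁆ (b ∷ G) (suc y) rewrite Vec.lookup-replicate y outside | restrict-zero (b ∷ G) zero =
      trans (ℚ.+-identityˡ _) (sum-restrict-⁅⁆ G y)

  sumOver-nbhd : ∀ (φ : Fin n → Fin n) X g → sumOver (nbhd φ X) g ≡ sum (λ j → restrict X (λ _ → g j) (φ j))
  sumOver-nbhd φ X g = trans (sumOver≡sum (nbhd φ X) g)
    (sum-cong-≗ (λ j → cong (λ b → if b then g j else 0ℚ) (Vec.lookup∘tabulate (λ j → lookup X (φ j)) j)))

  sumOver-nbhd-⁅⁆ : ∀ (φ : Fin n → Fin n) G g →
                    sumOver G (λ x → sumOver (nbhd φ ⁅ x ⁆) g) ≡ sumOver (nbhd φ G) g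
  sumOver-nbhd-⁅⁆ φ G g = begin
    sumOver G (λ x → sumOver (nbhd φ ⁅ x ⁆) g)                        ≡⟨ sumOver-cong G (λ x → sumOver-nbhd φ ⁅ x ⁆ g) ⟩
    sumOver G (λ x → sum (λ j → restrict ⁅ x ⁆ (λ _ → g j) (φ j)))    ≡⟨ sumOver-sum-comm G (λ x j → restrict ⁅ x ⁆ (λ _ → g j) (φ j)) ⟩
    sum (λ j → sumOver G (λ x → restrict ⁅ x ⁆ (λ _ → g j) (φ j)))    ≡⟨ sum-cong-≗ (λ j → sumOver-⁅⁆ G (φ j) (g j)) ⟩
    sum (λ j → restrict G (λ _ → g j) (φ j))                          ≡⟨ sumOver-nbhd φ G g ⟨
    sumOver (nbhd φ G) g                                               ∎
    where open ≡-Reasoning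

  sumOver²-+ : ∀ (A B : Subset n) a b →
               sumOver A (λ x → sumOver B (λ y → a x +ℚ b y)) ≡ ∣ B ∣ ×ℚ sumOver A a +ℚ ∣ A ∣ ×ℚ sumOver B b
  sumOver²-+ A B a b = begin
    sumOver A (λ x → sumOver B (λ y → a x +ℚ b y))                 ≡⟨ sumOver-cong A inner ⟩
    sumOver A (λ x → ∣ B ∣ ×ℚ a x +ℚ sumOver B b)                  ≡⟨ sumOver-+ A (λ x → ∣ B ∣ ×ℚ a x) (λ _ → sumOver B b) ⟩
    sumOver A (λ x → ∣ B ∣ ×ℚ a x) +ℚ sumOver A (λ _ → sumOver B b) ≡⟨ cong₂ _+ℚ_ (sumOver-× A ∣ B ∣ a) (sumOver-const A _) ⟩
    ∣ B ∣ ×ℚ sumOver A a +ℚ ∣ A ∣ ×ℚ sumOver B b                    ∎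
    where
    open ≡-Reasoning
    inner : ∀ x → sumOver B (λ y → a x +ℚ b y) ≡ ∣ B ∣ ×ℚ a x +ℚ sumOver B b
    inner x = trans (sumOver-+ B _ b) (cong (_+ℚ sumOver B b) (sumOver-const B (a x)))

minList-≤ : ∀ {e y xs} → y ∈ₗ xs → minList e xs ≤ℚ y
minList-≤ {y = y} {x ∷ xs} y∈x∷xs = foldr-preservesᵒ ⊓-≤ x xs (≤-here-or-there y∈x∷xs)
  where
  ⊓-≤ : ∀ p q → p ≤ℚ y ⊎ q ≤ℚ y → p ⊓ q ≤ℚ y
  ⊓-≤ p q (inj₁ p≤y) = ℚ.≤-trans (ℚ.p⊓q≤p p q) p≤y
  ⊓-≤ p q (inj₂ q≤y) = ℚ.≤-trans (ℚ.p⊓q≤q p q) q≤y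

  ≤-here-or-there : ∀ {x xs} → y ∈ₗ x ∷ xs → x ≤ℚ y ⊎ Any.Any (_≤ℚ y) xs
  ≤-here-or-there (here y≡x)  = inj₁ (ℚ.≤-reflexive (sym y≡x))
  ≤-here-or-there (there y∈xs) = inj₂ (Any.map (ℚ.≤-reflexive ∘ sym) y∈xs)

≤-minList : ∀ {v e y xs} → y ∈ₗ xs → All (v ≤ℚ_) xs → v ≤ℚ minList e xs
≤-minList {xs = x ∷ xs} _ (v≤x ∷ v≤xs) = foldr-preservesᵇ ℚ.⊓-glb v≤x v≤xs

module _ {n : ℕ} (d : Fin n → Fin n → ℚ) (j : Fin n) (G : Subset n) where

  private
    distances : List (Fin n) → List ℚ
    distances = foldr (λ i acc → if lookup G i then d j i ∷ acc else acc) []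

    ∈-distances : ∀ {g} is → g ∈ₗ is → g ∈ G → d j g ∈ₗ distances is
    ∈-distances {g} (i ∷ is) (here refl) g∈G rewrite Vec.[]=⇒lookup g∈G = here refl
    ∈-distances     (i ∷ is) (there g∈is) g∈G with lookup G i
    ... | true  = there (∈-distances is g∈is g∈G)
    ... | false = ∈-distances is g∈is g∈G

    All-distances : ∀ {P : ℚ → Set} → (∀ g → g ∈ G → P (d j g)) → ∀ is → All P (distances is)
    All-distances P-G []       = []
    All-distances P-G (i ∷ is) with lookup G i in eq
    ... | true  = P-G i (Vec.lookup⇒[]= i G eq) ∷ All-distances P-G is
    ... | false = All-distances P-G is

  distSet-≤ : ∀ {g} → g ∈ G → distSet d j G ≤ℚ d j g
  distSet-≤ {g} g∈G = minList-≤ (∈-distances (allFin n) (∈-allFin g) g∈G)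

  ≤-distSet : ∀ {g v} → g ∈ G → (∀ g → g ∈ G → v ≤ℚ d j g) → v ≤ℚ distSet d j G
  ≤-distSet {g} g∈G v≤ = ≤-minList (∈-distances (allFin n) (∈-allFin g) g∈G) (All-distances v≤ (allFin n))

distSet-closest : ∀ {n} {d : Fin n → Fin n → ℚ} {G φ} → IsClosestMap d G φ → ∀ j → distSet d j G ≡ d j (φ j)
distSet-closest {d = d} {G} φ-closest j =
  ℚ.≤-antisym (distSet-≤ d j G (proj₁ (φ-closest j))) (≤-distSet d j G (proj₁ (φ-closest j)) (proj₂ (φ-closest j)))

swap : ∀ {n} → Subset n → Fin n → Fin n → Subset n
swap F f r = (F ∪ ⁅ f ⁆) ─ ⁅ r ⁆

module _ {n : ℕ} where

  ∈-swap-added : ∀ {F : Subset n} {f r} → f ≢ r → f ∈ swap F f r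
  ∈-swap-added {f = f} f≢r =
    Subsetₚ.x∈p∧x∉q⇒x∈p─q (Subsetₚ.x∈p∪q⁺ (inj₂ (Subsetₚ.x∈⁅x⁆ f))) (Subsetₚ.x≢y⇒x∉⁅y⁆ f≢r)

  ∈-swap-kept : ∀ {F : Subset n} {f r g} → g ∈ F → g ≢ r → g ∈ swap F f r
  ∈-swap-kept g∈F g≢r = Subsetₚ.x∈p∧x∉q⇒x∈p─q (Subsetₚ.x∈p∪q⁺ (inj₁ g∈F)) (Subsetₚ.x≢y⇒x∉⁅y⁆ g≢r)

  ∈⇒0<∣p∣ : ∀ {x} {p : Subset n} → x ∈ p → 0 < ∣ p ∣
  ∈⇒0<∣p∣ {x} {p} x∈p = ℕ.≤-trans (ℕ.≤-reflexive (sym (Subsetₚ.∣⁅x⁆∣≡1 x))) (Subsetₚ.p⊆q⇒∣p∣≤∣q∣ ⁅x⁆⊆p)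
    where
    ⁅x⁆⊆p : ⁅ x ⁆ ⊆ p
    ⁅x⁆⊆p y∈⁅x⁆ rewrite Subsetₚ.x∈⁅y⁆⇒x≡y x y∈⁅x⁆ = x∈p

  ∈-preimage : ∀ {Fs X : Subset n} {η x} → x ∈ Fs → η x ∈ X → x ∈ preimage Fs η X
  ∈-preimage {Fs} {X} {η} {x} x∈Fs ηx∈X = Vec.lookup⇒[]= x _
    (trans (Vec.lookup∘tabulate (λ i → lookup Fs i ∧ lookup X (η i)) x)
           (cong₂ _∧_ (Vec.[]=⇒lookup x∈Fs) (Vec.[]=⇒lookup ηx∈X)))

  preimage-⊆ : ∀ (Fs : Subset n) η X → preimage Fs η X ⊆ Fs
  preimage-⊆ Fs η X {x} x∈pre = Vec.lookup⇒[]= x Fs (∧-true-left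
    (trans (sym (Vec.lookup∘tabulate (λ i → lookup Fs i ∧ lookup X (η i)) x)) (Vec.[]=⇒lookup x∈pre)))
    where
    ∧-true-left : ∀ {a b} → (a ∧ b) ≡ true → a ≡ true
    ∧-true-left {true} _ = refl

  nbhd-mono : ∀ (φ : Fin n → Fin n) {X Y : Subset n} → X ⊆ Y → nbhd φ X ⊆ nbhd φ Y
  nbhd-mono φ {X} {Y} X⊆Y {j} j∈NX = Vec.lookup⇒[]= j _ (trans (Vec.lookup∘tabulate (λ j → lookup Y (φ j)) j)
    (Vec.[]=⇒lookup (X⊆Y (Vec.lookup⇒[]= (φ j) X
      (trans (sym (Vec.lookup∘tabulate (λ j → lookup X (φ j)) j)) (Vec.[]=⇒lookup j∈NX))))))

  deg≡0⇒∉image : ∀ {Fs : Subset n} {η x r} → x ∈ Fs → deg Fs η r ≡ 0 → η x ≢ r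
  deg≡0⇒∉image {Fs} {η} {x} x∈Fs deg≡0 refl =
    ℕ.<⇒≢ (∈⇒0<∣p∣ (∈-preimage {Fs} {⁅ η x ⁆} {η} x∈Fs (Subsetₚ.x∈⁅x⁆ (η x)))) (sym deg≡0)

  IsBlock⇒⊆ : ∀ {Fs : Subset n} {η G R} → IsBlock Fs η G R → R ⊆ G
  IsBlock⇒⊆ (r , Z , r∈G , _ , Z⊆G , _ , _ , refl) x∈R with Subsetₚ.x∈p∪q⁻ ⁅ r ⁆ Z x∈R
  ... | inj₁ x∈⁅r⁆ rewrite Subsetₚ.x∈⁅y⁆⇒x≡y r x∈⁅r⁆ = r∈G
  ... | inj₂ x∈Z = Z⊆G x∈Z

  Constructed⇒⊆ : ∀ {Fs : Subset n} {η G Gs R Fi} → Constructed Fs η G Gs R Fi →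
                  Gs ⊆ Fs → R ⊆ G × Fi ⊆ Fs
  Constructed⇒⊆ {Fs} {η} (here {R = R} block) _ = IsBlock⇒⊆ {Fs = Fs} {η} block , preimage-⊆ Fs η R
  Constructed⇒⊆ {Fs} {η} (there {G = G} {Gs} {R'} _ rest) Gs⊆Fs
    with Constructed⇒⊆ rest (Gs⊆Fs ∘ Subsetₚ.p─q⊆p Gs (preimage Fs η R'))
  ... | R⊆G─R' , Fi⊆Fs = Subsetₚ.p─q⊆p G R' ∘ R⊆G─R' , Fi⊆Fs
  Constructed⇒⊆ (final _) Gs⊆Fs = id , Gs⊆Fs

module SwapBound {n} {d : Fin n → Fin n → ℚ} (metric : IsMetric d)
  {F Fs : Subset n} {η : Fin n → Fin n}
  (η-closest : ∀ f → f ∈ Fs → η f ∈ F × (∀ g → g ∈ F → d f (η f) ≤ℚ d f g))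
  {φ φs : Fin n → Fin n} (φ-closest : IsClosestMap d F φ) (φs-closest : IsClosestMap d Fs φs) where

  open IsMetric metric

  A O : Fin n → ℚ
  A j = d j (φ j)
  O j = d j (φs j)

  2O-nonneg : ∀ j → 0ℚ ≤ℚ (1ℚ +ℚ 1ℚ) *ℚ O j
  2O-nonneg j = ℚ.≤-trans (ℚ.+-mono-≤ (nonneg j (φs j)) (nonneg j (φs j)))
                          (ℚ.≤-reflexive (solve 1 (λ o → o :+ o := (con 1ℚ :+ con 1ℚ) :* o) refl (O j)))

  η-fixes : ∀ {f} → f ∈ Fs → f ∈ F → η f ≡ f
  η-fixes {f} f∈Fs f∈F = sym (zero-iff₂ f (η f) (ℚ.≤-antisym
    (ℚ.≤-trans (proj₂ (η-closest f f∈Fs) f f∈F) (ℚ.≤-reflexive (zero-iff₁ f))) (nonneg f (η f))))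

  dist-η∘φs : ∀ j → d j (η (φs j)) ≤ℚ d j (φs j) +ℚ (d j (φs j) +ℚ d j (φ j))
  dist-η∘φs j = begin
    d j (η (φs j))                            ≤⟨ triangle j (φs j) (η (φs j)) ⟩
    d j (φs j) +ℚ d (φs j) (η (φs j))         ≤⟨ ℚ.+-monoʳ-≤ (d j (φs j)) η-φs-closest ⟩
    d j (φs j) +ℚ d (φs j) (φ j)              ≤⟨ ℚ.+-monoʳ-≤ (d j (φs j)) (triangle (φs j) j (φ j)) ⟩
    d j (φs j) +ℚ (d (φs j) j +ℚ d j (φ j))   ≡⟨ cong (λ o → d j (φs j) +ℚ (o +ℚ d j (φ j))) (symm (φs j) j) ⟩
    d j (φs j) +ℚ (d j (φs j) +ℚ d j (φ j))   ∎
    where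
    open ℚ.≤-Reasoning
    η-φs-closest = proj₂ (η-closest (φs j) (proj₁ (φs-closest j))) (φ j) (proj₁ (φ-closest j))

  module _ {f r} (f∈Fs : f ∈ Fs) (r∈F : r ∈ F) (deg-r≡0 : deg Fs η r ≡ 0) where

    f≢r : f ≢ r
    f≢r refl = deg≡0⇒∉image f∈Fs deg-r≡0 (η-fixes f∈Fs r∈F)

    cost-f cost-r : Fin n → ℚ
    cost-f j = restrict ⁅ f ⁆ (λ _ → O j -ℚ A j) (φs j)
    cost-r j = restrict ⁅ r ⁆ (λ _ → (1ℚ +ℚ 1ℚ) *ℚ O j) (φ j)

    distSet-swap-≤ : ∀ j → distSet d j (swap F f r) ≤ℚ A j +ℚ (cost-f j +ℚ cost-r j)
    distSet-swap-≤ j with φs j ≟ f | φ j ≟ r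
    ... | yes φs-j≡f | _ = begin
      distSet d j (swap F f r)          ≤⟨ distSet-≤ d j _ (∈-swap-added {F = F} f≢r) ⟩
      d j f                             ≡⟨ cong (d j) φs-j≡f ⟨
      O j                               ≡⟨ solve 2 (λ O A → O := A :+ ((O :- A) :+ con 0ℚ)) refl (O j) (A j) ⟩
      A j +ℚ ((O j -ℚ A j) +ℚ 0ℚ)       ≤⟨ ℚ.+-monoʳ-≤ (A j) (ℚ.+-mono-≤ (ℚ.≤-reflexive (sym cost-f≡))
                                                                        (restrict-nonneg ⁅ r ⁆ (λ _ → 2O-nonneg j) (φ j))) ⟩
      A j +ℚ (cost-f j +ℚ cost-r j)     ∎
      where
      open ℚ.≤-Reasoning
      cost-f≡ = restrict-∈ (λ _ → O j -ℚ A j) (subst (_∈ ⁅ f ⁆) (sym φs-j≡f) (Subsetₚ.x∈⁅x⁆ f))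
    ... | no φs-j≢f | yes φ-j≡r = begin
      distSet d j (swap F f r)          ≤⟨ distSet-≤ d j _ (∈-swap-kept η-φs-j∈F η-φs-j≢r) ⟩
      d j (η (φs j))                    ≤⟨ dist-η∘φs j ⟩
      O j +ℚ (O j +ℚ A j)               ≡⟨ solve 2 (λ O A → O :+ (O :+ A) := A :+ (con 0ℚ :+ (con 1ℚ :+ con 1ℚ) :* O))
                                                   refl (O j) (A j) ⟩
      A j +ℚ (0ℚ +ℚ (1ℚ +ℚ 1ℚ) *ℚ O j)  ≡⟨ cong (A j +ℚ_) (cong₂ _+ℚ_ cost-f≡ cost-r≡) ⟨
      A j +ℚ (cost-f j +ℚ cost-r j)     ∎
      where
      open ℚ.≤-Reasoning
      η-φs-j∈F = proj₁ (η-closest (φs j) (proj₁ (φs-closest j)))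
      η-φs-j≢r = deg≡0⇒∉image (proj₁ (φs-closest j)) deg-r≡0
      cost-f≡ = restrict-∉ (λ _ → O j -ℚ A j) (Subsetₚ.x≢y⇒x∉⁅y⁆ φs-j≢f)
      cost-r≡ = restrict-∈ (λ _ → (1ℚ +ℚ 1ℚ) *ℚ O j) (subst (_∈ ⁅ r ⁆) (sym φ-j≡r) (Subsetₚ.x∈⁅x⁆ r))
    ... | no φs-j≢f | no φ-j≢r = begin
      distSet d j (swap F f r)          ≤⟨ distSet-≤ d j _ (∈-swap-kept (proj₁ (φ-closest j)) φ-j≢r) ⟩
      A j                               ≡⟨ solve 1 (λ A → A := A :+ (con 0ℚ :+ con 0ℚ)) refl (A j) ⟩
      A j +ℚ (0ℚ +ℚ 0ℚ)                 ≡⟨ cong (A j +ℚ_) (cong₂ _+ℚ_ cost-f≡ cost-r≡) ⟨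
      A j +ℚ (cost-f j +ℚ cost-r j)     ∎
      where
      open ℚ.≤-Reasoning
      cost-f≡ = restrict-∉ (λ _ → O j -ℚ A j) (Subsetₚ.x≢y⇒x∉⁅y⁆ φs-j≢f)
      cost-r≡ = restrict-∉ (λ _ → (1ℚ +ℚ 1ℚ) *ℚ O j) (Subsetₚ.x≢y⇒x∉⁅y⁆ φ-j≢r)

    swap-bound : kmed d (swap F f r) -ℚ kmed d F ≤ℚ
                 sumOver (nbhd φs ⁅ f ⁆) (λ j → O j -ℚ A j) +ℚ sumOver (nbhd φ ⁅ r ⁆) (λ j → (1ℚ +ℚ 1ℚ) *ℚ O j)
    swap-bound = p≤q+r⇒p-q≤r (begin
      kmed d (swap F f r)                                    ≡⟨ kmed≡sum d (swap F f r) ⟩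
      sum (λ j → distSet d j (swap F f r))                   ≤⟨ sum-mono distSet-swap-≤′ ⟩
      sum (λ j → distSet d j F +ℚ (cost-f j +ℚ cost-r j))    ≡⟨ ∑-distrib-+ (λ j → distSet d j F) (λ j → cost-f j +ℚ cost-r j) ⟩
      sum (λ j → distSet d j F) +ℚ sum (λ j → cost-f j +ℚ cost-r j)
                                                             ≡⟨ cong₂ _+ℚ_ (sym (kmed≡sum d F)) (∑-distrib-+ cost-f cost-r) ⟩
      kmed d F +ℚ (sum cost-f +ℚ sum cost-r)                 ≡⟨ cong (kmed d F +ℚ_) (cong₂ _+ℚ_ (sumOver-nbhd φs ⁅ f ⁆ _)
                                                                                                  (sumOver-nbhd φ ⁅ r ⁆ _)) ⟨
      kmed d F +ℚ (sumOver (nbhd φs ⁅ f ⁆) (λ j → O j -ℚ A j) +ℚ sumOver (nbhd φ ⁅ r ⁆) (λ j → (1ℚ +ℚ 1ℚ) *ℚ O j)) ∎)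
      where
      open ℚ.≤-Reasoning
      distSet-swap-≤′ : ∀ j → distSet d j (swap F f r) ≤ℚ distSet d j F +ℚ (cost-f j +ℚ cost-r j)
      distSet-swap-≤′ j = subst (λ a → distSet d j (swap F f r) ≤ℚ a +ℚ (cost-f j +ℚ cost-r j))
                                (sym (distSet-closest φ-closest j)) (distSet-swap-≤ j)

mainTheorem7 :
  (n : ℕ) (d : Fin n → Fin n → ℚ) → IsMetric d →
  (F Fs : Subset n) (k : ℕ) → ∣ F ∣ ≡ k → ∣ Fs ∣ ≡ k →
  (t : ℕ) → 1 ≤ t →
  (η : Fin n → Fin n) → (∀ f → f ∈ Fs → η f ∈ F × (∀ g → g ∈ F → d f (η f) ≤ℚ d f g)) →
  (φ φs : Fin n → Fin n) → IsClosestMap d F φ → IsClosestMap d Fs φs →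
  (R Fi : Subset n) → Constructed Fs η F Fs R Fi →
  (s : ℕ) → ∣ R ∣ ≡ s → ∣ Fi ∣ ≡ s → t < s →
  (Rh : Subset n) → Rh ⊆ R → ∣ Rh ∣ ≡ s ∸ 1 → (∀ x → x ∈ Rh → deg Fs η x ≡ 0) →
  inv (s ∸ 1) *ℚ sumOver Fi (λ f → sumOver Rh (λ r →
      kmed d ((F ∪ ⁅ f ⁆) ─ ⁅ r ⁆) -ℚ kmed d F))
    ≤ℚ
  sumOver (nbhd φs Fi) (λ j → d j (φs j) -ℚ d j (φ j))
    +ℚ sumOver (nbhd φ R) (λ j → (1ℚ +ℚ 1ℚ) *ℚ (1ℚ +ℚ inv t) *ℚ d j (φs j))
mainTheorem7 _ d metric F Fs _ _ _ (suc t) _ η η-closest φ φs φ-closest φs-closest R Fi constructed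
             (suc (suc m)) _ ∣Fi∣≡s (s≤s (s≤s t≤m)) Rh Rh⊆R ∣Rh∣≡s-1 Rh-deg≡0 = begin
  w *ℚ sumOver Fi (λ f → sumOver Rh (λ r → kmed d (swap F f r) -ℚ kmed d F))
    ≤⟨ ℚ.*-monoˡ-≤-nonNeg w {{nonNegative (inv-nonneg (suc m))}} (sumOver-mono Fi λ f f∈Fi → sumOver-mono Rh λ r r∈Rh →
         swap-bound (Fi⊆Fs f∈Fi) (R⊆F (Rh⊆R r∈Rh)) (Rh-deg≡0 r r∈Rh)) ⟩
  w *ℚ sumOver Fi (λ f → sumOver Rh (λ r → a f +ℚ b r))
    ≡⟨ cong (w *ℚ_) (sumOver²-+ Fi Rh a b) ⟩
  w *ℚ (∣ Rh ∣ ×ℚ sumOver Fi a +ℚ ∣ Fi ∣ ×ℚ sumOver Rh b)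
    ≡⟨ cong (w *ℚ_) (cong₂ _+ℚ_ (cong₂ _×ℚ_ ∣Rh∣≡s-1 (sumOver-nbhd-⁅⁆ φs Fi X))
                                (cong₂ _×ℚ_ ∣Fi∣≡s (sumOver-nbhd-⁅⁆ φ Rh Y))) ⟩
  w *ℚ (suc m ×ℚ P +ℚ suc (suc m) ×ℚ sumOver (nbhd φ Rh) Y)
    ≤⟨ average-bound t≤m P (sumOver-nonneg (nbhd φ Rh) 2O-nonneg) (sumOver-mono-⊆ (nbhd-mono φ Rh⊆R) 2O-nonneg) ⟩
  P +ℚ c *ℚ sumOver (nbhd φ R) Y
    ≡⟨ cong (P +ℚ_) (trans (sumOver-cong (nbhd φ R) regroup) (sumOver-*ˡ (nbhd φ R) c Y)) ⟨
  P +ℚ sumOver (nbhd φ R) (λ j → (1ℚ +ℚ 1ℚ) *ℚ c *ℚ O j) ∎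
  where
  open ℚ.≤-Reasoning
  open SwapBound metric η-closest φ-closest φs-closest
  R⊆F = proj₁ (Constructed⇒⊆ constructed id)
  Fi⊆Fs = proj₂ (Constructed⇒⊆ constructed id)
  w = inv (suc m)
  c = 1ℚ +ℚ inv (suc t)
  X Y : Fin _ → ℚ
  X j = O j -ℚ A j
  Y j = (1ℚ +ℚ 1ℚ) *ℚ O j
  a b : Fin _ → ℚ
  a f = sumOver (nbhd φs ⁅ f ⁆) X
  b r = sumOver (nbhd φ ⁅ r ⁆) Y
  P = sumOver (nbhd φs Fi) X
  regroup : ∀ j → (1ℚ +ℚ 1ℚ) *ℚ c *ℚ O j ≡ c *ℚ Y j
  regroup j = solve 2 (λ c o → (con 1ℚ :+ con 1ℚ) :* c :* o := c :* ((con 1ℚ :+ con 1ℚ) :* o)) refl c (O j)
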